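{- Let $u,v$ be independent, each uniformly distributed on $\mathcal B_n$. There exists $\eta>0$ such that for all $n\ge3$ and all $1\le i\le n-1$, $\mathbb E[\Delta_i(u,v)]\ge\eta$.
   Context: $\mathcal B_n$ is the set of Boolean permutations in $S_n$ (expressible as a product of simple transpositions $s_i=(i\ i{+}1)$ with no $s_i$ repeated). For $w\in S_n$ and $j\in[n]$, $\chi_j(w)=1$ if there exists $k<j$ with $w(k)>w(j)$, else $0$. $\Delta_i(u,v):=1-\chi_i(u)-\chi_i(v)$. -}

module Defs where

open import Data.Nat using (ℕ; zero; suc; _<_; _∸_; _<ᵇ_)
open import Data.Integer using (ℤ; +_; _-_)
open import Data.Integer as ℤ using ()
open import Data.Rational using (ℚ; _/_)
open import Data.Bool using (Bool; true; false; if_then_else_)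
open import Data.List using (List; []; _∷_; foldl; upTo; take; map; length)
open import Data.Bool.ListAction using (any)
open import Data.List.Relation.Unary.All using (All)
open import Data.List.Relation.Unary.Unique.Propositional using (Unique)
open import Data.Product using (Σ; _×_)
open import Relation.Binary.PropositionalEquality using (_≡_)

-- Permutations of [n] are written in one-line notation with 0-based values:
-- w : List ℕ is the list  w(1), …, w(n)  (values in 0 … n-1).

-- Right multiplication by the simple transposition s_{a+1} (0-based index a):
-- swaps the entries at positions a and a+1 of the one-line notation.
swapAdj : ℕ → List ℕ → List ℕ
swapAdj zero (x ∷ y ∷ l) = y ∷ x ∷ l
swapAdj zero l = l
swapAdj (suc a) [] = []
swapAdj (suc a) (x ∷ l) = x ∷ swapAdj a l

-- The permutation s_{a₁+1} s_{a₂+1} ⋯ s_{a_k+1} in S_n (word of 0-based indices).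
wordPerm : ℕ → List ℕ → List ℕ
wordPerm n word = foldl (λ l a → swapAdj a l) (upTo n) word

IsBoolean : ℕ → List ℕ → Set
IsBoolean n w = Σ (List ℕ) λ word →
  Unique word × All (λ a → suc a < n) word × wordPerm n word ≡ w

-- entry at 0-based position p (default 0 outside the range)
at : List ℕ → ℕ → ℕ
at [] p = 0
at (x ∷ l) zero = x
at (x ∷ l) (suc p) = at l p

-- χ_j(w) for 1-based j: 1 iff some k < j has w(k) > w(j).
χ : ℕ → List ℕ → ℕ
χ j w = if any (λ x → at w (j ∸ 1) <ᵇ x) (take (j ∸ 1) w) then 1 else 0

Δ : ℕ → List ℕ → List ℕ → ℤ
Δ i u v = + 1 - + χ i u - + χ i v

sumℤ : List ℤ → ℤ
sumℤ [] = + 0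
sumℤ (x ∷ l) = x ℤ.+ sumℤ l

sumΔ : ℕ → List (List ℕ) → ℤ
sumΔ i L = sumℤ (map (λ u → sumℤ (map (λ v → Δ i u v) L)) L)

ℕtoℚ : ℕ → ℚ
ℕtoℚ m = + m / 1

ℤtoℚ : ℤ → ℚ
ℤtoℚ z = z / 1

-- A Boolean permutation of S_{m+1} is determined by recording, for every generator s_{k+1}, whether
-- it is absent or stands to the left or to the right of s_k in a reduced word; the last two choices
-- coincide when s_k is absent.  Building the permutation generator by generator, χ_{t+1} = 1 exactly
-- when s_t is used and s_{t+1} is not placed to its right, and later generators do not change this.
-- So, after step t, the numbers of codes without and with the last generator, and the numbers of
-- those with χ_{t+1} = 1, obey the same recursion (p, q) ↦ (p + q, p + 2q).  A cone invariant under
-- this recursion shows that χ_{t+1} = 1 on at most 10/21 of 𝓑_n, and since E[Δ_i] = 1 - 2 E[χ_i],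
-- the constant η = 1/21 works.

module Submission where

module BooleanPermutations where

  open import Defs
  open import Data.Bool using (Bool; true; false; _∨_; if_then_else_)
  open import Data.Bool.ListAction using (any; or)
  open import Data.Bool.Properties using (T-≡)
  open import Data.Empty using (⊥-elim)
  open import Data.Integer as ℤ using (ℤ; +_)
  import Data.Integer.Properties as ℤP
  open import Data.Integer.Tactic.RingSolver using () renaming (solve-∀ to ℤ-solve-∀)
  open import Data.List using (List; []; _∷_; _++_; _∷ʳ_; [_]; map; length; foldl; upTo; take)
  open import Data.List.Properties
    using (length-++; length-map; length-upTo; map-++; map-∘; map-cong; map-cong-local; map-id-local;
           foldl-++; foldl-∷ʳ; upTo-∷ʳ; take-map; take-all;
           ∷-injectiveˡ; ∷-injectiveʳ; ∷ʳ-injectiveˡ; ∷ʳ-injectiveʳ)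
  open import Data.List.Membership.Propositional using (_∈_; _∉_; find; lose)
  open import Data.List.Membership.Propositional.Properties
    using (∈-map⁺; ∈-map⁻; ∈-++⁺ˡ; ∈-++⁺ʳ; ∈-++⁻; ∈-∃++)
  open import Data.List.Membership.Propositional.Properties.WithK using (unique∧set⇒bag)
  open import Data.List.Relation.Binary.BagAndSetEquality using (∼bag⇒↭)
  open import Data.List.Relation.Binary.Disjoint.Propositional using (Disjoint)
  open import Data.List.Relation.Binary.Permutation.Propositional using (_↭_; prep; swap; ↭-refl)
  open import Data.List.Relation.Binary.Permutation.Propositional.Properties
    using (All-resp-↭; ∈-resp-↭; ↭-length; map⁺)
  open import Data.List.Relation.Unary.All as All using (All; []; _∷_)
  import Data.List.Relation.Unary.All.Properties as All
  open import Data.List.Relation.Unary.AllPairs using ([]; _∷_)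
  open import Data.List.Relation.Unary.Any using (here; there; any?)
  import Data.List.Relation.Unary.Any.Properties as Any
  open import Data.List.Relation.Unary.Unique.Propositional using (Unique)
  import Data.List.Relation.Unary.Unique.Propositional.Properties as Unique
  open import Data.Nat
  open import Data.Nat.ListAction using (sum)
  open import Data.Nat.ListAction.Properties using (sum-++; sum-↭)
  open import Data.Nat.Properties
  open import Data.Nat.Tactic.RingSolver using (solve-∀)
  open import Data.List.Membership.DecPropositional _≟_ using (_∈?_)
  open import Data.Product using (Σ-syntax; _×_; _,_; proj₁; proj₂)
  open import Data.Rational using (ℚ; 0ℚ; toℚᵘ)
    renaming (_<_ to _<ℚ_; _≤_ to _≤ℚ_; _*_ to _*ℚ_; _/_ to _/ℚ_)
  import Data.Rational.Properties as ℚP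
  open import Data.Rational.Unnormalised as ℚᵘ using (mkℚᵘ)
  import Data.Rational.Unnormalised.Properties as ℚᵘP
  open import Data.Sum using (inj₁; inj₂)
  open import Data.Unit using (⊤)
  open import Function using (_∘_; Equivalence; _⇔_; mk⇔)
  open import Relation.Binary.PropositionalEquality hiding ([_])
  open import Relation.Nullary using (yes; no)

  -- Simple transpositions in one-line notation

  swapAdj-length : ∀ a l → length (swapAdj a l) ≡ length l
  swapAdj-length zero    []          = refl
  swapAdj-length zero    (x ∷ [])    = refl
  swapAdj-length zero    (x ∷ y ∷ l) = refl
  swapAdj-length (suc a) []          = refl
  swapAdj-length (suc a) (x ∷ l)     = cong suc (swapAdj-length a l)

  ↭-swapAdj : ∀ a l → l ↭ swapAdj a l
  ↭-swapAdj zero    []          = ↭-refl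
  ↭-swapAdj zero    (x ∷ [])    = ↭-refl
  ↭-swapAdj zero    (x ∷ y ∷ l) = swap x y ↭-refl
  ↭-swapAdj (suc a) []          = ↭-refl
  ↭-swapAdj (suc a) (x ∷ l)     = prep x (↭-swapAdj a l)

  swapAdj-involutive : ∀ a l → swapAdj a (swapAdj a l) ≡ l
  swapAdj-involutive zero    []          = refl
  swapAdj-involutive zero    (x ∷ [])    = refl
  swapAdj-involutive zero    (x ∷ y ∷ l) = refl
  swapAdj-involutive (suc a) []          = refl
  swapAdj-involutive (suc a) (x ∷ l)     = cong (x ∷_) (swapAdj-involutive a l)

  swapAdj-++ : ∀ a l r → suc a < length l → swapAdj a (l ++ r) ≡ swapAdj a l ++ r
  swapAdj-++ zero    (x ∷ y ∷ l) r _           = refl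
  swapAdj-++ zero    (x ∷ [])    r (s≤s ())
  swapAdj-++ (suc a) (x ∷ l)     r (s≤s a+1<l) = cong (x ∷_) (swapAdj-++ a l r a+1<l)

  swapAdj-map : ∀ (f : ℕ → ℕ) a l → swapAdj a (map f l) ≡ map f (swapAdj a l)
  swapAdj-map f zero    []          = refl
  swapAdj-map f zero    (x ∷ [])    = refl
  swapAdj-map f zero    (x ∷ y ∷ l) = refl
  swapAdj-map f (suc a) []          = refl
  swapAdj-map f (suc a) (x ∷ l)     = cong (f x ∷_) (swapAdj-map f a l)

  swapAdj-comm : ∀ a b l → suc a < b → swapAdj b (swapAdj a l) ≡ swapAdj a (swapAdj b l)
  swapAdj-comm zero    (suc zero)    l           (s≤s ())
  swapAdj-comm zero    (suc (suc b)) []          _         = refl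
  swapAdj-comm zero    (suc (suc b)) (x ∷ [])    _         = refl
  swapAdj-comm zero    (suc (suc b)) (x ∷ y ∷ l) _         = refl
  swapAdj-comm (suc a) (suc b)       []          _         = refl
  swapAdj-comm (suc a) (suc b)       (x ∷ l)     (s≤s a<b) = cong (x ∷_) (swapAdj-comm a b l a<b)

  swapAdj-∷ʳ-∷ʳ : ∀ {k} u y z → length u ≡ k → swapAdj k ((u ∷ʳ y) ∷ʳ z) ≡ (u ∷ʳ z) ∷ʳ y
  swapAdj-∷ʳ-∷ʳ []      y z refl = refl
  swapAdj-∷ʳ-∷ʳ (x ∷ u) y z refl = cong (x ∷_) (swapAdj-∷ʳ-∷ʳ u y z refl)

  -- τ k exchanges the values k and suc k, so map (τ k) is left multiplication by s_{k+1}.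
  τ : ℕ → ℕ → ℕ
  τ zero    zero          = 1
  τ zero    (suc zero)    = 0
  τ zero    (suc (suc x)) = suc (suc x)
  τ (suc k) zero          = zero
  τ (suc k) (suc x)       = suc (τ k x)

  τ-self : ∀ k → τ k k ≡ suc k
  τ-self zero    = refl
  τ-self (suc k) = cong suc (τ-self k)

  τ-suc : ∀ k → τ k (suc k) ≡ k
  τ-suc zero    = refl
  τ-suc (suc k) = cong suc (τ-suc k)

  τ-< : ∀ k {x} → x < k → τ k x ≡ x
  τ-< (suc k) {zero}  _         = refl
  τ-< (suc k) {suc x} (s≤s x<k) = cong suc (τ-< k x<k)

  τ-involutive : ∀ k x → τ k (τ k x) ≡ x
  τ-involutive zero    zero          = refl
  τ-involutive zero    (suc zero)    = refl
  τ-involutive zero    (suc (suc x)) = refl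
  τ-involutive (suc k) zero          = refl
  τ-involutive (suc k) (suc x)       = cong suc (τ-involutive k x)

  τ-≤ : ∀ k {x} → x ≤ suc k → τ k x ≤ suc k
  τ-≤ zero    {zero}          _         = s≤s z≤n
  τ-≤ zero    {suc zero}      _         = z≤n
  τ-≤ zero    {suc (suc x)}   (s≤s ())
  τ-≤ (suc k) {zero}          _         = z≤n
  τ-≤ (suc k) {suc x}         (s≤s x≤k) = s≤s (τ-≤ k x≤k)

  τ-<ᵇ : ∀ k {x y} → x ≤ k → y ≤ k → (τ k x <ᵇ τ k y) ≡ (x <ᵇ y)
  τ-<ᵇ zero    {zero}  {zero}  _         _         = refl
  τ-<ᵇ (suc k) {zero}  {zero}  _         _         = refl
  τ-<ᵇ (suc k) {zero}  {suc y} _         _         = refl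
  τ-<ᵇ (suc k) {suc x} {zero}  _         _         = refl
  τ-<ᵇ (suc k) {suc x} {suc y} (s≤s x≤k) (s≤s y≤k) = τ-<ᵇ k x≤k y≤k

  map-τ-involutive : ∀ k l → map (τ k) (map (τ k) l) ≡ l
  map-τ-involutive k l = trans (sym (map-∘ l)) (map-id-local (All.tabulate (λ {x} _ → τ-involutive k x)))

  map-τ-< : ∀ k {l} → All (_< k) l → map (τ k) l ≡ l
  map-τ-< k l<k = map-id-local (All.map (τ-< k) l<k)

  swapAdj≡map-τ : ∀ {k} u → All (_< k) u → length u ≡ k →
                  swapAdj k ((u ∷ʳ k) ∷ʳ suc k) ≡ map (τ k) ((u ∷ʳ k) ∷ʳ suc k)
  swapAdj≡map-τ {k} u u<k |u|≡k = begin
    swapAdj k ((u ∷ʳ k) ∷ʳ suc k)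
      ≡⟨ swapAdj-∷ʳ-∷ʳ u k (suc k) |u|≡k ⟩
    (u ∷ʳ suc k) ∷ʳ k
      ≡⟨ cong₂ (λ v w → (v ∷ʳ w) ∷ʳ k) (sym (map-τ-< k u<k)) (sym (τ-self k)) ⟩
    (map (τ k) u ∷ʳ τ k k) ∷ʳ k
      ≡⟨ cong ((map (τ k) u ∷ʳ τ k k) ∷ʳ_) (sym (τ-suc k)) ⟩
    (map (τ k) u ∷ʳ τ k k) ∷ʳ τ k (suc k)
      ≡⟨ cong (_∷ʳ τ k (suc k)) (sym (map-++ (τ k) u [ k ])) ⟩
    map (τ k) (u ∷ʳ k) ∷ʳ τ k (suc k)
      ≡⟨ sym (map-++ (τ k) (u ∷ʳ k) [ suc k ]) ⟩
    map (τ k) ((u ∷ʳ k) ∷ʳ suc k)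
      ∎
    where open ≡-Reasoning

  swaps : List ℕ → List ℕ → List ℕ
  swaps l W = foldl (λ l a → swapAdj a l) l W

  swaps-++ : ∀ l r W → All (λ a → suc a < length l) W → swaps (l ++ r) W ≡ swaps l W ++ r
  swaps-++ l r []      []           = refl
  swaps-++ l r (a ∷ W) (a<l ∷ W<l) = begin
    swaps (swapAdj a (l ++ r)) W
      ≡⟨ cong (λ l′ → swaps l′ W) (swapAdj-++ a l r a<l) ⟩
    swaps (swapAdj a l ++ r) W
      ≡⟨ swaps-++ (swapAdj a l) r W (subst (λ n → All (λ b → suc b < n) W) (sym (swapAdj-length a l)) W<l) ⟩
    swaps (swapAdj a l) W ++ r
      ∎
    where open ≡-Reasoning

  swaps-map : ∀ (f : ℕ → ℕ) l W → swaps (map f l) W ≡ map f (swaps l W)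
  swaps-map f l []      = refl
  swaps-map f l (a ∷ W) = trans (cong (λ l′ → swaps l′ W) (swapAdj-map f a l)) (swaps-map f (swapAdj a l) W)

  swaps-swapAdj : ∀ k l W → All (λ a → suc a < k) W → swaps (swapAdj k l) W ≡ swapAdj k (swaps l W)
  swaps-swapAdj k l []      []          = refl
  swaps-swapAdj k l (a ∷ W) (a<k ∷ W<k) =
    trans (cong (λ l′ → swaps l′ W) (sym (swapAdj-comm a k l a<k))) (swaps-swapAdj k (swapAdj a l) W W<k)

  upTo-< : ∀ n → All (_< n) (upTo n)
  upTo-< n = All.applyUpTo⁺₁ _ n (λ i<n → i<n)

  upTo-2+ : ∀ k → (upTo k ∷ʳ k) ∷ʳ suc k ≡ upTo (2 + k)
  upTo-2+ k = trans (cong (_∷ʳ suc k) (upTo-∷ʳ k)) (upTo-∷ʳ (suc k))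

  wordPerm-suc : ∀ k W → All (_< k) W → wordPerm (2 + k) W ≡ wordPerm (suc k) W ∷ʳ suc k
  wordPerm-suc k W W<k = trans (cong (λ l → swaps l W) (sym (upTo-∷ʳ (suc k))))
    (swaps-++ (upTo (suc k)) [ suc k ] W
      (All.map (λ {a} a<k → subst (suc a <_) (sym (length-upTo (suc k))) (s≤s a<k)) W<k))

  wordPerm-∷ : ∀ k W → wordPerm (2 + k) (k ∷ W) ≡ map (τ k) (wordPerm (2 + k) W)
  wordPerm-∷ k W = begin
    swaps (swapAdj k (upTo (2 + k))) W
      ≡⟨ cong (λ l → swaps (swapAdj k l) W) (sym (upTo-2+ k)) ⟩
    swaps (swapAdj k ((upTo k ∷ʳ k) ∷ʳ suc k)) W
      ≡⟨ cong (λ l → swaps l W) (swapAdj≡map-τ (upTo k) (upTo-< k) (length-upTo k)) ⟩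
    swaps (map (τ k) ((upTo k ∷ʳ k) ∷ʳ suc k)) W
      ≡⟨ cong (λ l → swaps (map (τ k) l) W) (upTo-2+ k) ⟩
    swaps (map (τ k) (upTo (2 + k))) W
      ≡⟨ swaps-map (τ k) (upTo (2 + k)) W ⟩
    map (τ k) (wordPerm (2 + k) W)
      ∎
    where open ≡-Reasoning

  wordPerm-∷ʳ : ∀ n W a → wordPerm n (W ∷ʳ a) ≡ swapAdj a (wordPerm n W)
  wordPerm-∷ʳ n W a = foldl-∷ʳ (λ l b → swapAdj b l) (upTo n) a W

  wordPerm-commuteˡ : ∀ n k X Y → All (λ x → suc x < k) X →
                      wordPerm n (X ++ k ∷ Y) ≡ wordPerm n (k ∷ X ++ Y)
  wordPerm-commuteˡ n k X Y X<k = begin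
    wordPerm n (X ++ k ∷ Y)                 ≡⟨ foldl-++ _ (upTo n) X (k ∷ Y) ⟩
    swaps (swapAdj k (swaps (upTo n) X)) Y  ≡⟨ cong (λ l → swaps l Y) (sym (swaps-swapAdj k (upTo n) X X<k)) ⟩
    swaps (swaps (swapAdj k (upTo n)) X) Y  ≡⟨ sym (foldl-++ _ (swapAdj k (upTo n)) X Y) ⟩
    wordPerm n (k ∷ X ++ Y)                 ∎
    where open ≡-Reasoning

  wordPerm-commuteʳ : ∀ n k X Y → All (λ y → suc y < k) Y →
                      wordPerm n (X ++ k ∷ Y) ≡ wordPerm n ((X ++ Y) ∷ʳ k)
  wordPerm-commuteʳ n k X Y Y<k = begin
    wordPerm n (X ++ k ∷ Y)                 ≡⟨ foldl-++ _ (upTo n) X (k ∷ Y) ⟩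
    swaps (swapAdj k (swaps (upTo n) X)) Y  ≡⟨ swaps-swapAdj k (swaps (upTo n) X) Y Y<k ⟩
    swapAdj k (swaps (swaps (upTo n) X) Y)  ≡⟨ cong (swapAdj k) (sym (foldl-++ _ (upTo n) X Y)) ⟩
    swapAdj k (wordPerm n (X ++ Y))         ≡⟨ sym (wordPerm-∷ʳ n (X ++ Y) k) ⟩
    wordPerm n ((X ++ Y) ∷ʳ k)              ∎
    where open ≡-Reasoning

  -- Codes of Boolean permutations

  -- In a Boolean word s_{k+1} commutes with every letter except s_k, so the permutation only
  -- depends on whether s_{k+1} is absent, or stands left or right of s_k, for each k.
  -- place p k w extends w ∈ S_{k+1} to S_{k+2}, adding s_{k+1} at place p.
  data Place : Set where
    none left right : Place

  place : Place → ℕ → List ℕ → List ℕ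
  place none  k w = w ∷ʳ suc k
  place left  k w = map (τ k) (w ∷ʳ suc k)
  place right k w = swapAdj k (w ∷ʳ suc k)

  -- A code of length m stands for an element of S_{m+1}; its head is the place of s_m.
  build : List Place → List ℕ
  build []       = 0 ∷ []
  build (p ∷ ps) = place p (length ps) (build ps)

  uses : List Place → Bool
  uses []          = false
  uses (none ∷ _)  = false
  uses (left ∷ _)  = true
  uses (right ∷ _) = true

  -- Without s_k the places left and right give the same permutation; a canonical code says left.
  Canonical : List Place → Set
  Canonical []           = ⊤
  Canonical (none ∷ ps)  = Canonical ps
  Canonical (left ∷ ps)  = Canonical ps
  Canonical (right ∷ ps) = uses ps ≡ true × Canonical ps

  Canonical-tail : ∀ p ps → Canonical (p ∷ ps) → Canonical ps
  Canonical-tail none  ps c       = c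
  Canonical-tail left  ps c       = c
  Canonical-tail right ps (_ , c) = c

  length-∷ʳ : ∀ (w : List ℕ) x → length (w ∷ʳ x) ≡ suc (length w)
  length-∷ʳ w x = trans (length-++ w) (+-comm (length w) 1)

  length-place : ∀ p k w → length (place p k w) ≡ suc (length w)
  length-place none  k w = length-∷ʳ w (suc k)
  length-place left  k w = trans (length-map (τ k) (w ∷ʳ suc k)) (length-∷ʳ w (suc k))
  length-place right k w = trans (swapAdj-length k (w ∷ʳ suc k)) (length-∷ʳ w (suc k))

  length-build : ∀ ps → length (build ps) ≡ suc (length ps)
  length-build []       = refl
  length-build (p ∷ ps) = trans (length-place p (length ps) (build ps)) (cong suc (length-build ps))

  place-left : ∀ k w → place left k w ≡ map (τ k) w ∷ʳ k
  place-left k w = trans (map-++ (τ k) w [ suc k ]) (cong (map (τ k) w ∷ʳ_) (τ-suc k))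

  ∷ʳ-bounded : ∀ {k w} → All (_≤ k) w → All (_≤ suc k) (w ∷ʳ suc k)
  ∷ʳ-bounded w≤k = All.++⁺ (All.map m≤n⇒m≤1+n w≤k) (≤-refl ∷ [])

  build-bounded : ∀ ps → All (_≤ length ps) (build ps)
  build-bounded []          = z≤n ∷ []
  build-bounded (none ∷ ps) = ∷ʳ-bounded (build-bounded ps)
  build-bounded (left ∷ ps) = All.map⁺ (All.map (τ-≤ (length ps)) (∷ʳ-bounded (build-bounded ps)))
  build-bounded (right ∷ ps) =
    All-resp-↭ (↭-swapAdj (length ps) (build ps ∷ʳ _)) (∷ʳ-bounded (build-bounded ps))

  length∈build : ∀ ps → length ps ∈ build ps
  length∈build []           = here refl
  length∈build (none ∷ ps)  = ∈-++⁺ʳ (build ps) (here refl)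
  length∈build (left ∷ ps)  =
    subst (_∈ build (left ∷ ps)) (τ-self (length ps)) (∈-map⁺ (τ (length ps)) (∈-++⁺ˡ (length∈build ps)))
  length∈build (right ∷ ps) =
    ∈-resp-↭ (↭-swapAdj (length ps) (build ps ∷ʳ _)) (∈-++⁺ʳ (build ps) (here refl))

  record Shape (ps : List Place) : Set where
    field
      init  : List ℕ
      last  : ℕ
      split : build ps ≡ init ∷ʳ last
      last< : uses ps ≡ true → last < length ps
      last≡ : uses ps ≡ false → last ≡ length ps × All (_< length ps) init

    length-init : length init ≡ length ps
    length-init =
      suc-injective (trans (sym (length-∷ʳ init last)) (trans (cong length (sym split)) (length-build ps)))

    length-init-∷ʳ : ∀ x → length (init ∷ʳ x) ≡ suc (length ps)
    length-init-∷ʳ x = trans (length-∷ʳ init x) (cong suc length-init)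

    split-right : place right (length ps) (build ps) ≡ (init ∷ʳ suc (length ps)) ∷ʳ last
    split-right = trans (cong (λ w → swapAdj (length ps) (w ∷ʳ suc (length ps))) split)
                        (swapAdj-∷ʳ-∷ʳ init last (suc (length ps)) length-init)

    last∈build : last ∈ build ps
    last∈build = subst (last ∈_) (sym split) (∈-++⁺ʳ init (here refl))

  shape : ∀ ps → Shape ps
  shape [] = record { init = [] ; last = 0 ; split = refl ; last< = λ () ; last≡ = λ _ → refl , [] }
  shape (none ∷ ps) = record
    { init = build ps ; last = suc (length ps) ; split = refl
    ; last< = λ () ; last≡ = λ _ → refl , All.map s≤s (build-bounded ps) }
  shape (left ∷ ps) = record
    { init = map (τ (length ps)) (build ps) ; last = length ps ; split = place-left (length ps) (build ps)
    ; last< = λ _ → n<1+n (length ps) ; last≡ = λ () }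
  shape (right ∷ ps) = record
    { init = init ∷ʳ suc (length ps) ; last = last ; split = split-right
    ; last< = λ _ → s≤s (All.lookup (build-bounded ps) last∈build) ; last≡ = λ () }
    where open Shape (shape ps)

  place-right≡place-left : ∀ ps → uses ps ≡ false →
                           place right (length ps) (build ps) ≡ place left (length ps) (build ps)
  place-right≡place-left ps unused = begin
    swapAdj k (build ps ∷ʳ suc k)     ≡⟨ cong (λ w → swapAdj k (w ∷ʳ suc k)) build≡ ⟩
    swapAdj k ((init ∷ʳ k) ∷ʳ suc k)  ≡⟨ swapAdj≡map-τ init (proj₂ (last≡ unused)) length-init ⟩
    map (τ k) ((init ∷ʳ k) ∷ʳ suc k)  ≡⟨ cong (λ w → map (τ k) (w ∷ʳ suc k)) (sym build≡) ⟩
    map (τ k) (build ps ∷ʳ suc k)     ∎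
    where
    open ≡-Reasoning
    open Shape (shape ps)
    k = length ps
    build≡ : build ps ≡ init ∷ʳ k
    build≡ = trans split (cong (init ∷ʳ_) (proj₁ (last≡ unused)))

  word : List Place → List ℕ
  word []           = []
  word (none ∷ ps)  = word ps
  word (left ∷ ps)  = length ps ∷ word ps
  word (right ∷ ps) = word ps ∷ʳ length ps

  word-< : ∀ ps → All (_< length ps) (word ps)
  word-< []           = []
  word-< (none ∷ ps)  = All.map m<n⇒m<1+n (word-< ps)
  word-< (left ∷ ps)  = n<1+n _ ∷ All.map m<n⇒m<1+n (word-< ps)
  word-< (right ∷ ps) = All.++⁺ (All.map m<n⇒m<1+n (word-< ps)) (n<1+n _ ∷ [])

  word-unique : ∀ ps → Unique (word ps)
  word-unique []           = []
  word-unique (none ∷ ps)  = word-unique ps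
  word-unique (left ∷ ps)  = All.map >⇒≢ (word-< ps) ∷ word-unique ps
  word-unique (right ∷ ps) = Unique.++⁺ (word-unique ps) ([] ∷ [])
    (λ where (a∈word , here refl) → <-irrefl refl (All.lookup (word-< ps) a∈word))

  wordPerm-word : ∀ ps → wordPerm (suc (length ps)) (word ps) ≡ build ps
  wordPerm-word []       = refl
  wordPerm-word (p ∷ ps) = by-place p
    where
    k = length ps
    extended : wordPerm (2 + k) (word ps) ≡ build ps ∷ʳ suc k
    extended = trans (wordPerm-suc k (word ps) (word-< ps)) (cong (_∷ʳ suc k) (wordPerm-word ps))
    by-place : ∀ p → wordPerm (2 + k) (word (p ∷ ps)) ≡ build (p ∷ ps)
    by-place none  = extended
    by-place left  = trans (wordPerm-∷ k (word ps)) (cong (map (τ k)) extended)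
    by-place right = trans (wordPerm-∷ʳ (2 + k) (word ps) k) (cong (swapAdj k) extended)

  build-isBoolean : ∀ ps → IsBoolean (suc (length ps)) (build ps)
  build-isBoolean ps = word ps , word-unique ps , All.map s≤s (word-< ps) , wordPerm-word ps

  HasCode : ℕ → List ℕ → Set
  HasCode k w = Σ[ ps ∈ List Place ] Canonical ps × length ps ≡ k × build ps ≡ w

  hasCode-none : ∀ {k w} → HasCode k w → HasCode (suc k) (place none k w)
  hasCode-none (ps , c , refl , refl) = none ∷ ps , c , refl , refl

  hasCode-left : ∀ {k w} → HasCode k w → HasCode (suc k) (place left k w)
  hasCode-left (ps , c , refl , refl) = left ∷ ps , c , refl , refl

  hasCode-right : ∀ {k w} → HasCode k w → HasCode (suc k) (place right k w)
  hasCode-right (ps , c , refl , refl) with uses ps in used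
  ... | true  = right ∷ ps , (used , c) , refl , refl
  ... | false = left ∷ ps , c , refl , sym (place-right≡place-left ps used)

  unique-middle : ∀ {A : Set} (X : List A) {k} Y → Unique (X ++ k ∷ Y) → Unique (X ++ Y) × k ∉ X ++ Y
  unique-middle []      Y (k∉Y ∷ uY) = uY , λ k∈Y → All.lookup k∉Y k∈Y refl
  unique-middle (x ∷ X) Y (x∉ ∷ u) with unique-middle X Y u
  ... | uXY , k∉XY = (All.++⁺ (All.++⁻ˡ X x∉) (All.tail (All.++⁻ʳ X x∉)) ∷ uXY) , λ where
    (here refl) → All.lookup x∉ (∈-++⁺ʳ X (here refl)) refl
    (there k∈XY) → k∉XY k∈XY

  unique-++-disjoint : ∀ {A : Set} (X : List A) {Y x} → Unique (X ++ Y) → x ∈ X → x ∉ Y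
  unique-++-disjoint (x ∷ X) (x∉ ∷ _) (here refl)  x∈Y = All.lookup (All.++⁻ʳ X x∉) x∈Y refl
  unique-++-disjoint (_ ∷ X) (_ ∷ u)  (there x∈X) = unique-++-disjoint X u x∈X

  All-<-refine : ∀ {k W} → All (_< suc k) W → k ∉ W → All (_< k) W
  All-<-refine W<1+k k∉W = All.tabulate λ {x} x∈W →
    ≤∧≢⇒< (≤-pred (All.lookup W<1+k x∈W)) (λ x≡k → k∉W (subst (_∈ _) x≡k x∈W))

  -- In the word X ++ k ∷ Y, s_{k+1} commutes with every letter on the side of it without s_k.
  hasCode-insert : ∀ k X Y → Unique (X ++ Y) → All (_< k) (X ++ Y) → HasCode k (wordPerm (suc k) (X ++ Y)) →
                   HasCode (suc k) (wordPerm (2 + k) (X ++ k ∷ Y))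
  hasCode-insert k X Y uXY XY<k c with any? (λ y → suc y ≟ k) Y
  ... | yes k-1∈Y = subst (HasCode (suc k)) left≡ (hasCode-left c)
    where
    X<k-1 : All (λ x → suc x < k) X
    X<k-1 = All.tabulate λ {x} x∈X → ≤∧≢⇒< (All.lookup XY<k (∈-++⁺ˡ x∈X)) λ 1+x≡k →
      let y , y∈Y , 1+y≡k = find k-1∈Y
      in unique-++-disjoint X uXY x∈X (subst (_∈ Y) (suc-injective (trans 1+y≡k (sym 1+x≡k))) y∈Y)
    left≡ : place left k (wordPerm (suc k) (X ++ Y)) ≡ wordPerm (2 + k) (X ++ k ∷ Y)
    left≡ = begin
      map (τ k) (wordPerm (suc k) (X ++ Y) ∷ʳ suc k)
        ≡⟨ cong (map (τ k)) (sym (wordPerm-suc k (X ++ Y) XY<k)) ⟩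
      map (τ k) (wordPerm (2 + k) (X ++ Y))
        ≡⟨ sym (wordPerm-∷ k (X ++ Y)) ⟩
      wordPerm (2 + k) (k ∷ X ++ Y)
        ≡⟨ sym (wordPerm-commuteˡ (2 + k) k X Y X<k-1) ⟩
      wordPerm (2 + k) (X ++ k ∷ Y)
        ∎
      where open ≡-Reasoning
  ... | no k-1∉Y = subst (HasCode (suc k)) right≡ (hasCode-right c)
    where
    Y<k-1 : All (λ y → suc y < k) Y
    Y<k-1 = All.tabulate λ y∈Y →
      ≤∧≢⇒< (All.lookup XY<k (∈-++⁺ʳ X y∈Y)) (λ 1+y≡k → k-1∉Y (lose y∈Y 1+y≡k))
    right≡ : place right k (wordPerm (suc k) (X ++ Y)) ≡ wordPerm (2 + k) (X ++ k ∷ Y)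
    right≡ = begin
      swapAdj k (wordPerm (suc k) (X ++ Y) ∷ʳ suc k)
        ≡⟨ cong (swapAdj k) (sym (wordPerm-suc k (X ++ Y) XY<k)) ⟩
      swapAdj k (wordPerm (2 + k) (X ++ Y))
        ≡⟨ sym (wordPerm-∷ʳ (2 + k) (X ++ Y) k) ⟩
      wordPerm (2 + k) ((X ++ Y) ∷ʳ k)
        ≡⟨ sym (wordPerm-commuteʳ (2 + k) k X Y Y<k-1) ⟩
      wordPerm (2 + k) (X ++ k ∷ Y)
        ∎
      where open ≡-Reasoning

  wordPerm-hasCode : ∀ m W → Unique W → All (_< m) W → HasCode m (wordPerm (suc m) W)
  wordPerm-hasCode zero    []       _  _     = [] , _ , refl , refl
  wordPerm-hasCode zero    (_ ∷ _)  _  (() ∷ _)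
  wordPerm-hasCode (suc k) W        uW W<1+k with k ∈? W
  ... | no k∉W =
    subst (HasCode (suc k)) (sym (wordPerm-suc k W W<k)) (hasCode-none (wordPerm-hasCode k W uW W<k))
    where W<k = All-<-refine W<1+k k∉W
  ... | yes k∈W with ∈-∃++ k∈W
  ...   | X , Y , refl with unique-middle X Y uW
  ...     | uXY , k∉XY = hasCode-insert k X Y uXY XY<k (wordPerm-hasCode k (X ++ Y) uXY XY<k)
    where
    XY<k = All-<-refine (All.++⁺ (All.++⁻ˡ X W<1+k) (All.tail (All.++⁻ʳ X W<1+k))) k∉XY

  isBoolean⇒hasCode : ∀ m {w} → IsBoolean (suc m) w → HasCode m w
  isBoolean⇒hasCode m (W , uW , W< , refl) = wordPerm-hasCode m W uW (All.map ≤-pred W<)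

  place-injective : ∀ p k {w w′} → place p k w ≡ place p k w′ → w ≡ w′
  place-injective none  k eq = ∷ʳ-injectiveˡ _ _ eq
  place-injective left  k eq = ∷ʳ-injectiveˡ _ _
    (trans (sym (map-τ-involutive k _)) (trans (cong (map (τ k)) eq) (map-τ-involutive k _)))
  place-injective right k eq = ∷ʳ-injectiveˡ _ _
    (trans (sym (swapAdj-involutive k _)) (trans (cong (swapAdj k) eq) (swapAdj-involutive k _)))

  -- The last entry of build (p ∷ ps) determines p.
  LastFits : Place → ℕ → ℕ → Set
  LastFits none  k y = y ≡ suc k
  LastFits left  k y = y ≡ k
  LastFits right k y = y < k

  LastFits-unique : ∀ p q {k y} → LastFits p k y → LastFits q k y → p ≡ q
  LastFits-unique none  none  _    _    = refl
  LastFits-unique none  left  refl ()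
  LastFits-unique none  right refl y<k  = ⊥-elim (1+n≰n (<⇒≤ y<k))
  LastFits-unique left  none  refl ()
  LastFits-unique left  left  _    _    = refl
  LastFits-unique left  right refl y<k  = ⊥-elim (n≮n _ y<k)
  LastFits-unique right none  y<k  refl = ⊥-elim (1+n≰n (<⇒≤ y<k))
  LastFits-unique right left  y<k  refl = ⊥-elim (n≮n _ y<k)
  LastFits-unique right right _    _    = refl

  last-fits : ∀ p ps → Canonical (p ∷ ps) → LastFits p (length ps) (Shape.last (shape (p ∷ ps)))
  last-fits none  ps _          = refl
  last-fits left  ps _          = refl
  last-fits right ps (used , _) = Shape.last< (shape ps) used

  last-cong : ∀ {c c′} → build c ≡ build c′ → Shape.last (shape c) ≡ Shape.last (shape c′)
  last-cong {c} {c′} eq =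
    ∷ʳ-injectiveʳ _ _ (trans (sym (Shape.split (shape c))) (trans eq (Shape.split (shape c′))))

  same-place : ∀ p q ps qs → Canonical (p ∷ ps) → Canonical (q ∷ qs) →
               length ps ≡ length qs → build (p ∷ ps) ≡ build (q ∷ qs) → p ≡ q
  same-place p q ps qs cp cq len eq = LastFits-unique p q (last-fits p ps cp)
    (subst₂ (LastFits q) (sym len) (sym (last-cong {p ∷ ps} {q ∷ qs} eq)) (last-fits q qs cq))

  build-injective : ∀ c c′ → Canonical c → Canonical c′ →
                    length c ≡ length c′ → build c ≡ build c′ → c ≡ c′
  build-injective []       []       _  _  _   _  = refl
  build-injective (p ∷ ps) (q ∷ qs) cp cq len eq
    with refl ← same-place p q ps qs cp cq (suc-injective len) eq =
      cong (p ∷_) (build-injective ps qs (Canonical-tail p ps cp) (Canonical-tail p qs cq) (suc-injective len)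
        (place-injective p (length ps) (trans eq (cong (λ k → place p k (build qs)) (sym (suc-injective len))))))

  -- χ read off the code

  -- Positions are 0-based here: χ (suc t) w is the indicator of χᵇ t w.
  χᵇ : ℕ → List ℕ → Bool
  χᵇ t w = any (at w t <ᵇ_) (take t w)

  <ᵇ-false : ∀ {m n} → n ≤ m → (m <ᵇ n) ≡ false
  <ᵇ-false {m}     {zero}  _         = refl
  <ᵇ-false {suc m} {suc n} (s≤s n≤m) = <ᵇ-false n≤m

  any-false : ∀ (f : ℕ → Bool) {l} → All (λ x → f x ≡ false) l → any f l ≡ false
  any-false f []         = refl
  any-false f (fx ∷ fl) = cong₂ _∨_ fx (any-false f fl)

  any-true : ∀ (f : ℕ → Bool) {x l} → x ∈ l → f x ≡ true → any f l ≡ true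
  any-true f x∈l fx = Equivalence.to T-≡ (Any.any⁺ f (lose x∈l (Equivalence.from T-≡ fx)))

  at-++ : ∀ t u r → t < length u → at (u ++ r) t ≡ at u t
  at-++ zero    (x ∷ u) r _         = refl
  at-++ (suc t) (x ∷ u) r (s≤s t<u) = at-++ t u r t<u

  at-length : ∀ u z r → at (u ++ z ∷ r) (length u) ≡ z
  at-length []      z r = refl
  at-length (x ∷ u) z r = at-length u z r

  at-map : ∀ (f : ℕ → ℕ) t w → t < length w → at (map f w) t ≡ f (at w t)
  at-map f zero    (x ∷ w) _         = refl
  at-map f (suc t) (x ∷ w) (s≤s t<w) = at-map f t w t<w

  at∈ : ∀ t w → t < length w → at w t ∈ w
  at∈ zero    (x ∷ w) _         = here refl
  at∈ (suc t) (x ∷ w) (s≤s t<w) = there (at∈ t w t<w)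

  take-++ : ∀ t (u r : List ℕ) → t ≤ length u → take t (u ++ r) ≡ take t u
  take-++ zero    u       r _         = refl
  take-++ (suc t) (x ∷ u) r (s≤s t≤u) = cong (x ∷_) (take-++ t u r t≤u)

  χᵇ-++ : ∀ t u r → t < length u → χᵇ t (u ++ r) ≡ χᵇ t u
  χᵇ-++ t u r t<u = cong₂ (λ y l → any (y <ᵇ_) l) (at-++ t u r t<u) (take-++ t u r (<⇒≤ t<u))

  χᵇ-∷ʳ : ∀ {t} u z → length u ≡ t → χᵇ t (u ∷ʳ z) ≡ any (z <ᵇ_) u
  χᵇ-∷ʳ u z refl = cong₂ (λ y l → any (y <ᵇ_) l) (at-length u z [])
    (trans (take-++ (length u) u [ z ] ≤-refl) (take-all (length u) u ≤-refl))

  χᵇ-τ : ∀ k t w → All (_≤ k) w → t < length w → χᵇ t (map (τ k) w) ≡ χᵇ t w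
  χᵇ-τ k t w w≤k t<w = begin
    any (at (map (τ k) w) t <ᵇ_) (take t (map (τ k) w))
      ≡⟨ cong₂ (λ y l → any (y <ᵇ_) l) (at-map (τ k) t w t<w) (take-map t w) ⟩
    any (τ k (at w t) <ᵇ_) (map (τ k) (take t w))
      ≡⟨ cong or (sym (map-∘ (take t w))) ⟩
    any (λ x → τ k (at w t) <ᵇ τ k x) (take t w)
      ≡⟨ cong or (map-cong-local (All.map (τ-<ᵇ k wₜ≤k) (All.take⁺ t w≤k))) ⟩
    any (at w t <ᵇ_) (take t w)
      ∎
    where
    open ≡-Reasoning
    wₜ≤k = All.lookup w≤k (at∈ t w t<w)

  any-1+k<ᵇ : ∀ {k l} → All (_≤ k) l → any (suc k <ᵇ_) l ≡ false
  any-1+k<ᵇ l≤k = any-false _ (All.map (λ x≤k → <ᵇ-false (m≤n⇒m≤1+n x≤k)) l≤k)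

  <-length : ∀ {t k} (w : List ℕ) → length w ≡ suc k → t ≤ k → t < length w
  <-length {t} w |w|≡1+k t≤k = subst (t <_) (sym |w|≡1+k) (s≤s t≤k)

  length-map-τ-build : ∀ ps → length (map (τ (length ps)) (build ps)) ≡ suc (length ps)
  length-map-τ-build ps = trans (length-map (τ (length ps)) (build ps)) (length-build ps)

  χᵇ-build-last : ∀ ps → χᵇ (length ps) (build ps) ≡ uses ps
  χᵇ-build-last []           = refl
  χᵇ-build-last (none ∷ ps)  =
    trans (χᵇ-∷ʳ (build ps) _ (length-build ps)) (any-1+k<ᵇ (build-bounded ps))
  χᵇ-build-last (left ∷ ps)  = begin
    χᵇ (suc k) (place left k (build ps))    ≡⟨ cong (χᵇ (suc k)) (place-left k (build ps)) ⟩
    χᵇ (suc k) (map (τ k) (build ps) ∷ʳ k)  ≡⟨ χᵇ-∷ʳ (map (τ k) (build ps)) k (length-map-τ-build ps) ⟩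
    any (k <ᵇ_) (map (τ k) (build ps))      ≡⟨ any-true _ 1+k∈ (Equivalence.to T-≡ (<⇒<ᵇ (n<1+n k))) ⟩
    true                                    ∎
    where
    open ≡-Reasoning
    k = length ps
    1+k∈ : suc k ∈ map (τ k) (build ps)
    1+k∈ = subst (_∈ map (τ k) (build ps)) (τ-self k) (∈-map⁺ (τ k) (length∈build ps))
  χᵇ-build-last (right ∷ ps) = begin
    χᵇ (suc k) (place right k (build ps))
      ≡⟨ cong (χᵇ (suc k)) split-right ⟩
    χᵇ (suc k) ((init ∷ʳ suc k) ∷ʳ last)
      ≡⟨ χᵇ-∷ʳ (init ∷ʳ suc k) last (length-init-∷ʳ (suc k)) ⟩
    any (last <ᵇ_) (init ∷ʳ suc k)
      ≡⟨ any-true _ (∈-++⁺ʳ init (here refl)) (Equivalence.to T-≡ (<⇒<ᵇ last<1+k)) ⟩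
    true
      ∎
    where
    open ≡-Reasoning
    open Shape (shape ps)
    k = length ps
    last<1+k = s≤s (All.lookup (build-bounded ps) last∈build)

  -- χᵇ k on build (p ∷ ps), k = length ps: placing s_{k+1} right moves the maximum suc k to
  -- position k, while the other places keep the value of χᵇ k on build ps.
  χ-placed : Place → List Place → Bool
  χ-placed right _  = false
  χ-placed _     ps = uses ps

  χᵇ-place-last : ∀ p ps → χᵇ (length ps) (build (p ∷ ps)) ≡ χ-placed p ps
  χᵇ-place-last none  ps =
    trans (χᵇ-++ _ (build ps) _ (<-length (build ps) (length-build ps) ≤-refl)) (χᵇ-build-last ps)
  χᵇ-place-last left  ps = begin
    χᵇ k (place left k (build ps))
      ≡⟨ cong (χᵇ k) (place-left k (build ps)) ⟩
    χᵇ k (map (τ k) (build ps) ∷ʳ k)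
      ≡⟨ χᵇ-++ k (map (τ k) (build ps)) _ (<-length (map (τ k) (build ps)) (length-map-τ-build ps) ≤-refl) ⟩
    χᵇ k (map (τ k) (build ps))
      ≡⟨ χᵇ-τ k k (build ps) (build-bounded ps) (<-length (build ps) (length-build ps) ≤-refl) ⟩
    χᵇ k (build ps)
      ≡⟨ χᵇ-build-last ps ⟩
    uses ps
      ∎
    where
    open ≡-Reasoning
    k = length ps
  χᵇ-place-last right ps = begin
    χᵇ k (place right k (build ps))
      ≡⟨ cong (χᵇ k) split-right ⟩
    χᵇ k ((init ∷ʳ suc k) ∷ʳ last)
      ≡⟨ χᵇ-++ k (init ∷ʳ suc k) _ (<-length (init ∷ʳ suc k) (length-init-∷ʳ (suc k)) ≤-refl) ⟩
    χᵇ k (init ∷ʳ suc k)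
      ≡⟨ χᵇ-∷ʳ init (suc k) length-init ⟩
    any (suc k <ᵇ_) init
      ≡⟨ any-1+k<ᵇ (All.++⁻ˡ init (subst (All (_≤ k)) split (build-bounded ps))) ⟩
    false
      ∎
    where
    open ≡-Reasoning
    open Shape (shape ps)
    k = length ps

  χᵇ-place-below : ∀ p ps t → t < length ps → χᵇ t (build (p ∷ ps)) ≡ χᵇ t (build ps)
  χᵇ-place-below none  ps t t<k = χᵇ-++ t (build ps) _ (<-length (build ps) (length-build ps) (<⇒≤ t<k))
  χᵇ-place-below left  ps t t<k = begin
    χᵇ t (place left k (build ps))
      ≡⟨ cong (χᵇ t) (place-left k (build ps)) ⟩
    χᵇ t (map (τ k) (build ps) ∷ʳ k)
      ≡⟨ χᵇ-++ t (map (τ k) (build ps)) _ (<-length (map (τ k) (build ps)) (length-map-τ-build ps) (<⇒≤ t<k)) ⟩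
    χᵇ t (map (τ k) (build ps))
      ≡⟨ χᵇ-τ k t (build ps) (build-bounded ps) (<-length (build ps) (length-build ps) (<⇒≤ t<k)) ⟩
    χᵇ t (build ps)
      ∎
    where
    open ≡-Reasoning
    k = length ps
  χᵇ-place-below right ps t t<k = begin
    χᵇ t (place right k (build ps))
      ≡⟨ cong (χᵇ t) split-right ⟩
    χᵇ t ((init ∷ʳ suc k) ∷ʳ last)
      ≡⟨ χᵇ-++ t (init ∷ʳ suc k) _ (<-length (init ∷ʳ suc k) (length-init-∷ʳ (suc k)) (<⇒≤ t<k)) ⟩
    χᵇ t (init ∷ʳ suc k)
      ≡⟨ χᵇ-++ t init _ t<init ⟩
    χᵇ t init
      ≡⟨ sym (χᵇ-++ t init _ t<init) ⟩
    χᵇ t (init ∷ʳ last)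
      ≡⟨ cong (χᵇ t) (sym split) ⟩
    χᵇ t (build ps)
      ∎
    where
    open ≡-Reasoning
    open Shape (shape ps)
    k = length ps
    t<init = subst (t <_) (sym length-init) t<k

  χᶜ : ℕ → List Place → Bool
  χᶜ t []       = false
  χᶜ t (p ∷ ps) with length ps ≟ t
  ... | yes _ = χ-placed p ps
  ... | no  _ = χᶜ t ps

  χᵇ-build : ∀ t ps → t < length ps → χᵇ t (build ps) ≡ χᶜ t ps
  χᵇ-build t (p ∷ ps) t<1+k with length ps ≟ t
  ... | yes refl = χᵇ-place-last p ps
  ... | no  k≢t  = trans (χᵇ-place-below p ps t t<k) (χᵇ-build t ps t<k)
    where t<k = ≤∧≢⇒< (≤-pred t<1+k) (k≢t ∘ sym)

  -- Enumeration of 𝓑_n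

  mutual
    codes : ℕ → List (List Place)
    codes a = codes-unused a ++ codes-used a

    codes-unused : ℕ → List (List Place)
    codes-unused zero    = [ [] ]
    codes-unused (suc a) = map (none ∷_) (codes a)

    codes-used : ℕ → List (List Place)
    codes-used zero    = []
    codes-used (suc a) = map (left ∷_) (codes a) ++ map (right ∷_) (codes-used a)

  mutual
    ∈-codes-unused : ∀ a {c} → c ∈ codes-unused a → Canonical c × length c ≡ a × uses c ≡ false
    ∈-codes-unused zero    (here refl) = _ , refl , refl
    ∈-codes-unused (suc a) c∈ with ∈-map⁻ (none ∷_) c∈
    ... | c′ , c′∈ , refl = proj₁ (∈-codes a c′∈) , cong suc (proj₂ (∈-codes a c′∈)) , refl

    ∈-codes-used : ∀ a {c} → c ∈ codes-used a → Canonical c × length c ≡ a × uses c ≡ true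
    ∈-codes-used (suc a) c∈ with ∈-++⁻ (map (left ∷_) (codes a)) c∈
    ... | inj₁ c∈l with ∈-map⁻ (left ∷_) c∈l
    ...   | c′ , c′∈ , refl = proj₁ (∈-codes a c′∈) , cong suc (proj₂ (∈-codes a c′∈)) , refl
    ∈-codes-used (suc a) c∈ | inj₂ c∈r with ∈-map⁻ (right ∷_) c∈r
    ...   | c′ , c′∈ , refl with ∈-codes-used a c′∈
    ...     | can , len , used = (used , can) , cong suc len , refl

    ∈-codes : ∀ a {c} → c ∈ codes a → Canonical c × length c ≡ a
    ∈-codes a c∈ with ∈-++⁻ (codes-unused a) c∈
    ... | inj₁ c∈u = proj₁ (∈-codes-unused a c∈u) , proj₁ (proj₂ (∈-codes-unused a c∈u))
    ... | inj₂ c∈u = proj₁ (∈-codes-used a c∈u) , proj₁ (proj₂ (∈-codes-used a c∈u))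

  unused∉used : ∀ a {c} → c ∈ codes-unused a → c ∉ codes-used a
  unused∉used a c∈u c∈U
    with trans (sym (proj₂ (proj₂ (∈-codes-unused a c∈u)))) (proj₂ (proj₂ (∈-codes-used a c∈U)))
  ... | ()

  codes-complete : ∀ c → Canonical c → c ∈ codes (length c)
  codes-complete []          _            = here refl
  codes-complete (none ∷ c)  can          = ∈-++⁺ˡ (∈-map⁺ (none ∷_) (codes-complete c can))
  codes-complete (left ∷ c)  can          =
    ∈-++⁺ʳ (codes-unused (suc (length c))) (∈-++⁺ˡ (∈-map⁺ (left ∷_) (codes-complete c can)))
  codes-complete (right ∷ c) (used , can) with ∈-++⁻ (codes-unused (length c)) (codes-complete c can)
  ... | inj₁ c∈u with trans (sym used) (proj₂ (proj₂ (∈-codes-unused (length c) c∈u)))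
  ...   | ()
  codes-complete (right ∷ c) (used , can) | inj₂ c∈U =
    ∈-++⁺ʳ (codes-unused (suc (length c)))
      (∈-++⁺ʳ (map (left ∷_) (codes (length c))) (∈-map⁺ (right ∷_) c∈U))

  map-∷-disjoint : ∀ {p q : Place} xs ys → p ≢ q → Disjoint (map (p ∷_) xs) (map (q ∷_) ys)
  map-∷-disjoint xs ys p≢q (c∈p , c∈q) with ∈-map⁻ _ c∈p | ∈-map⁻ _ c∈q
  ... | _ , _ , refl | _ , _ , eq = p≢q (∷-injectiveˡ eq)

  mutual
    codes-unused-unique : ∀ a → Unique (codes-unused a)
    codes-unused-unique zero    = [] ∷ []
    codes-unused-unique (suc a) = Unique.map⁺ ∷-injectiveʳ (codes-unique a)

    codes-used-unique : ∀ a → Unique (codes-used a)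
    codes-used-unique zero    = []
    codes-used-unique (suc a) =
      Unique.++⁺ (Unique.map⁺ ∷-injectiveʳ (codes-unique a))
                 (Unique.map⁺ ∷-injectiveʳ (codes-used-unique a))
                 (map-∷-disjoint {left} {right} (codes a) (codes-used a) λ ())

    codes-unique : ∀ a → Unique (codes a)
    codes-unique a =
      Unique.++⁺ (codes-unused-unique a) (codes-used-unique a) λ (c∈u , c∈U) → unused∉used a c∈u c∈U

  booleans : ℕ → List (List ℕ)
  booleans m = map build (codes m)

  ∈-booleans⇔ : ∀ m {w} → w ∈ booleans m ⇔ IsBoolean (suc m) w
  ∈-booleans⇔ m = mk⇔ to from
    where
    to : ∀ {w} → w ∈ booleans m → IsBoolean (suc m) w
    to w∈ with ∈-map⁻ build w∈
    ... | c , c∈ , refl =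
      subst (λ k → IsBoolean (suc k) (build c)) (proj₂ (∈-codes m c∈)) (build-isBoolean c)
    from : ∀ {w} → IsBoolean (suc m) w → w ∈ booleans m
    from isB with isBoolean⇒hasCode m isB
    ... | c , can , refl , refl = ∈-map⁺ build (codes-complete c can)

  unique-map : ∀ {A B : Set} (f : A → B) {xs} → (∀ {x y} → x ∈ xs → y ∈ xs → f x ≡ f y → x ≡ y) →
               Unique xs → Unique (map f xs)
  unique-map f {[]}     _   []         = []
  unique-map f {x ∷ xs} inj (x∉ ∷ uxs) =
    All.map⁺ (All.tabulate λ y∈ fx≡fy → All.lookup x∉ y∈ (inj (here refl) (there y∈) fx≡fy))
    ∷ unique-map f (λ x∈ y∈ → inj (there x∈) (there y∈)) uxs

  booleans-unique : ∀ m → Unique (booleans m)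
  booleans-unique m = unique-map build build-injectiveOn (codes-unique m)
    where
    build-injectiveOn : ∀ {c c′} → c ∈ codes m → c′ ∈ codes m → build c ≡ build c′ → c ≡ c′
    build-injectiveOn c∈ c′∈ with ∈-codes m c∈ | ∈-codes m c′∈
    ... | can , len | can′ , len′ = build-injective _ _ can can′ (trans len (sym len′))

  -- Counting

  sumBy : {A : Set} → (A → ℕ) → List A → ℕ
  sumBy f xs = sum (map f xs)

  sumBy-cong : ∀ {A : Set} {f g : A → ℕ} xs → (∀ {x} → x ∈ xs → f x ≡ g x) →
               sumBy f xs ≡ sumBy g xs
  sumBy-cong xs f≗g = cong sum (map-cong-local (All.tabulate f≗g))

  sumBy-++ : ∀ {A : Set} (f : A → ℕ) xs ys → sumBy f (xs ++ ys) ≡ sumBy f xs + sumBy f ys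
  sumBy-++ f xs ys = trans (cong sum (map-++ f xs ys)) (sum-++ (map f xs) (map f ys))

  sumBy-map : ∀ {A B : Set} (f : B → ℕ) (g : A → B) xs → sumBy f (map g xs) ≡ sumBy (f ∘ g) xs
  sumBy-map f g xs = cong sum (sym (map-∘ xs))

  sumBy-const : ∀ {A : Set} n (xs : List A) → sumBy (λ _ → n) xs ≡ length xs * n
  sumBy-const n []       = refl
  sumBy-const n (x ∷ xs) = cong (λ s → n + s) (sumBy-const n xs)

  sumBy-zero : ∀ {A : Set} (xs : List A) → sumBy (λ _ → 0) xs ≡ 0
  sumBy-zero xs = trans (sumBy-const 0 xs) (*-zeroʳ (length xs))

  sumBy-*ˡ : ∀ {A : Set} n (f : A → ℕ) xs → sumBy (λ x → n * f x) xs ≡ n * sumBy f xs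
  sumBy-*ˡ n f []       = sym (*-zeroʳ n)
  sumBy-*ˡ n f (x ∷ xs) =
    trans (cong (λ s → n * f x + s) (sumBy-*ˡ n f xs)) (sym (*-distribˡ-+ n (f x) _))

  tally : (List Place → ℕ) → ℕ → ℕ × ℕ
  tally f a = sumBy f (codes-unused a) , sumBy f (codes-used a)

  total : ℕ × ℕ → ℕ
  total (p , q) = p + q

  grow : ℕ × ℕ → ℕ × ℕ
  grow (p , q) = p + q , (p + q) + q

  total-tally : ∀ f a → total (tally f a) ≡ sumBy f (codes a)
  total-tally f a = sym (sumBy-++ f (codes-unused a) (codes-used a))

  tally-suc : ∀ f a → (∀ p {c} → c ∈ codes a → f (p ∷ c) ≡ f c) →
              tally f (suc a) ≡ grow (tally f a)
  tally-suc f a f-∷ = cong₂ _,_ unused-suc used-suc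
    where
    open ≡-Reasoning
    sum-∷ : ∀ p {cs} → (∀ {c} → c ∈ cs → c ∈ codes a) → sumBy f (map (p ∷_) cs) ≡ sumBy f cs
    sum-∷ p {cs} cs⊆ = trans (sumBy-map f (p ∷_) cs) (sumBy-cong cs (f-∷ p ∘ cs⊆))
    unused-suc : sumBy f (codes-unused (suc a)) ≡ total (tally f a)
    unused-suc = trans (sum-∷ none (λ c∈ → c∈)) (sym (total-tally f a))
    used-suc : sumBy f (codes-used (suc a)) ≡ total (tally f a) + sumBy f (codes-used a)
    used-suc = begin
      sumBy f (map (left ∷_) (codes a) ++ map (right ∷_) (codes-used a))
        ≡⟨ sumBy-++ f (map (left ∷_) (codes a)) _ ⟩
      sumBy f (map (left ∷_) (codes a)) + sumBy f (map (right ∷_) (codes-used a))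
        ≡⟨ cong₂ _+_ (sum-∷ left (λ c∈ → c∈)) (sum-∷ right (∈-++⁺ʳ (codes-unused a))) ⟩
      sumBy f (codes a) + sumBy f (codes-used a)
        ≡⟨ cong (_+ sumBy f (codes-used a)) (sym (total-tally f a)) ⟩
      total (tally f a) + sumBy f (codes-used a)
        ∎

  one : List Place → ℕ
  one _ = 1

  counts : ℕ → ℕ × ℕ
  counts = tally one

  counts-suc : ∀ a → counts (suc a) ≡ grow (counts a)
  counts-suc a = tally-suc one a (λ _ _ → refl)

  Balanced : ℕ × ℕ → Set
  Balanced (p , q) = 3 * q ≤ 5 * p

  balanced-grow : ∀ pq → Balanced pq → Balanced (grow pq)
  balanced-grow (p , q) 3q≤5p = subst₂ _≤_ (lhs p q) (rhs p q) (+-monoʳ-≤ (3 * p + 5 * q) q≤2p)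
    where
    q≤2p : q ≤ 2 * p
    q≤2p = *-cancelˡ-≤ 3 (≤-trans 3q≤5p (≤-trans (*-monoˡ-≤ p (m≤m+n 5 1))
                                                    (≤-reflexive (*-assoc 3 2 p))))
    lhs : ∀ p q → 3 * p + 5 * q + q ≡ 3 * ((p + q) + q)
    lhs = solve-∀
    rhs : ∀ p q → 3 * p + 5 * q + 2 * p ≡ 5 * (p + q)
    rhs = solve-∀

  counts-balanced : ∀ a → Balanced (counts a)
  counts-balanced zero    = z≤n
  counts-balanced (suc a) =
    subst Balanced (sym (counts-suc a)) (balanced-grow (counts a) (counts-balanced a))

  -- 10/21 is the least constant for which dominated-start follows from the bound 5/3 of Balanced.
  Dominated : ℕ × ℕ → ℕ × ℕ → Set
  Dominated (x , y) (p , q) = 21 * y ≤ 10 * q × 21 * (x + y) ≤ 10 * (p + q)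

  dominated-grow : ∀ xy pq → Dominated xy pq → Dominated (grow xy) (grow pq)
  dominated-grow (x , y) (p , q) (y≤ , x+y≤) = used≤ , total≤
    where
    used≤ : 21 * ((x + y) + y) ≤ 10 * ((p + q) + q)
    used≤ = subst₂ _≤_ (sym (*-distribˡ-+ 21 (x + y) y)) (sym (*-distribˡ-+ 10 (p + q) q))
                      (+-mono-≤ x+y≤ y≤)
    total≤ : 21 * ((x + y) + ((x + y) + y)) ≤ 10 * ((p + q) + ((p + q) + q))
    total≤ = subst₂ _≤_ (sym (*-distribˡ-+ 21 (x + y) _)) (sym (*-distribˡ-+ 10 (p + q) _))
                       (+-mono-≤ x+y≤ used≤)

  dominated-start : ∀ p q → Balanced (p , q) → Dominated (q , q) (grow (p , q))
  dominated-start p q 3q≤5p = used≤ , total≤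
    where
    q≤10p : q ≤ 10 * p
    q≤10p = ≤-trans (m≤n*m q 3) (≤-trans 3q≤5p (*-monoˡ-≤ p (m≤m+n 5 5)))
    used≤ : 21 * q ≤ 10 * ((p + q) + q)
    used≤ = subst₂ _≤_ (lhs q) (rhs p q) (+-monoˡ-≤ (20 * q) q≤10p)
      where
      lhs : ∀ q → q + 20 * q ≡ 21 * q
      lhs = solve-∀
      rhs : ∀ p q → 10 * p + 20 * q ≡ 10 * ((p + q) + q)
      rhs = solve-∀
    total≤ : 21 * (q + q) ≤ 10 * ((p + q) + ((p + q) + q))
    total≤ = subst₂ _≤_ (lhs q) (rhs p q) (+-monoˡ-≤ (30 * q) (*-monoʳ-≤ 4 3q≤5p))
      where
      lhs : ∀ q → 4 * (3 * q) + 30 * q ≡ 21 * (q + q)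
      lhs = solve-∀
      rhs : ∀ p q → 4 * (5 * p) + 30 * q ≡ 10 * ((p + q) + ((p + q) + q))
      rhs = solve-∀

  indicator : Bool → ℕ
  indicator b = if b then 1 else 0

  sumBy-uses : ∀ a → sumBy (indicator ∘ uses) (codes a) ≡ proj₂ (counts a)
  sumBy-uses a = begin
    sumBy (indicator ∘ uses) (codes a)
      ≡⟨ sumBy-++ (indicator ∘ uses) (codes-unused a) (codes-used a) ⟩
    sumBy (indicator ∘ uses) (codes-unused a) + sumBy (indicator ∘ uses) (codes-used a)
      ≡⟨ cong₂ _+_ (sumBy-cong (codes-unused a) (λ c∈ → cong indicator (proj₂ (proj₂ (∈-codes-unused a c∈)))))
                   (sumBy-cong (codes-used a) (λ c∈ → cong indicator (proj₂ (proj₂ (∈-codes-used a c∈))))) ⟩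
    sumBy (λ _ → 0) (codes-unused a) + sumBy one (codes-used a)
      ≡⟨ cong (_+ sumBy one (codes-used a)) (sumBy-zero (codes-unused a)) ⟩
    sumBy one (codes-used a)
      ∎
    where open ≡-Reasoning

  module _ (t : ℕ) where

    χᶜ-∷-≢ : ∀ p c → length c ≢ t → χᶜ t (p ∷ c) ≡ χᶜ t c
    χᶜ-∷-≢ p c c≢t with length c ≟ t
    ... | yes c≡t = ⊥-elim (c≢t c≡t)
    ... | no  _   = refl

    χᶜ-∷-≡ : ∀ p c → length c ≡ t → χᶜ t (p ∷ c) ≡ χ-placed p c
    χᶜ-∷-≡ p c c≡t with length c ≟ t
    ... | yes _   = refl
    ... | no  c≢t = ⊥-elim (c≢t c≡t)

    χ-weight : List Place → ℕ
    χ-weight = indicator ∘ χᶜ t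

    χ-tally : ℕ → ℕ × ℕ
    χ-tally = tally χ-weight

    χ-tally-start : χ-tally (suc t) ≡ (proj₂ (counts t) , proj₂ (counts t))
    χ-tally-start = cong₂ _,_ (trans (placed none length≡t) (sumBy-uses t)) (begin
      sumBy χ-weight (map (left ∷_) (codes t) ++ map (right ∷_) (codes-used t))
        ≡⟨ sumBy-++ χ-weight (map (left ∷_) (codes t)) _ ⟩
      sumBy χ-weight (map (left ∷_) (codes t)) + sumBy χ-weight (map (right ∷_) (codes-used t))
        ≡⟨ cong₂ _+_ (trans (placed left length≡t) (sumBy-uses t))
                     (trans (placed right (λ c∈ → proj₁ (proj₂ (∈-codes-used t c∈)))) (sumBy-zero (codes-used t))) ⟩
      proj₂ (counts t) + 0
        ≡⟨ +-identityʳ _ ⟩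
      proj₂ (counts t)
        ∎)
      where
      open ≡-Reasoning
      length≡t : ∀ {c} → c ∈ codes t → length c ≡ t
      length≡t c∈ = proj₂ (∈-codes t c∈)
      placed : ∀ p {cs} → (∀ {c} → c ∈ cs → length c ≡ t) →
               sumBy χ-weight (map (p ∷_) cs) ≡ sumBy (indicator ∘ χ-placed p) cs
      placed p {cs} cs≡t =
        trans (sumBy-map χ-weight (p ∷_) cs) (sumBy-cong cs (λ {c} c∈ → cong indicator (χᶜ-∷-≡ p c (cs≡t c∈))))

    χ-tally-suc : ∀ a → a ≢ t → χ-tally (suc a) ≡ grow (χ-tally a)
    χ-tally-suc a a≢t = tally-suc _ a λ p {c} c∈ →
      cong indicator (χᶜ-∷-≢ p c (λ c≡t → a≢t (trans (sym (proj₂ (∈-codes a c∈))) c≡t)))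

    χ-tally-dominated : ∀ a → t < a → Dominated (χ-tally a) (counts a)
    χ-tally-dominated (suc a) (s≤s t≤a) with t ≟ a
    ... | yes refl = subst₂ Dominated (sym χ-tally-start) (sym (counts-suc t))
                       (dominated-start (proj₁ (counts t)) (proj₂ (counts t)) (counts-balanced t))
    ... | no  t≢a  = subst₂ Dominated (sym (χ-tally-suc a (t≢a ∘ sym))) (sym (counts-suc a))
                       (dominated-grow (χ-tally a) (counts a) (χ-tally-dominated a (≤∧≢⇒< t≤a t≢a)))

    χ-booleans-bound : ∀ {m} → t < m → 21 * sum (map (χ (suc t)) (booleans m)) ≤ 10 * length (booleans m)
    χ-booleans-bound {m} t<m =
      subst₂ (λ x n → 21 * x ≤ 10 * n) χ-sum n-sum (proj₂ (χ-tally-dominated m t<m))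
      where
      χ-sum : total (χ-tally m) ≡ sum (map (χ (suc t)) (booleans m))
      χ-sum = begin
        total (χ-tally m)
          ≡⟨ total-tally χ-weight m ⟩
        sumBy χ-weight (codes m)
          ≡⟨ sumBy-cong (codes m) χ-agrees ⟩
        sumBy (χ (suc t) ∘ build) (codes m)
          ≡⟨ sym (sumBy-map (χ (suc t)) build (codes m)) ⟩
        sum (map (χ (suc t)) (booleans m))
          ∎
        where
        open ≡-Reasoning
        χ-agrees : ∀ {c} → c ∈ codes m → χ-weight c ≡ χ (suc t) (build c)
        χ-agrees {c} c∈ =
          cong indicator (sym (χᵇ-build t c (subst (t <_) (sym (proj₂ (∈-codes m c∈))) t<m)))
      n-sum : total (counts m) ≡ length (booleans m)
      n-sum = begin
        total (counts m)                         ≡⟨ total-tally one m ⟩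
        sumBy one (codes m)                      ≡⟨ sumBy-const 1 (codes m) ⟩
        length (codes m) * 1                     ≡⟨ *-identityʳ _ ⟩
        length (codes m)                         ≡⟨ sym (length-map build (codes m)) ⟩
        length (booleans m)                      ∎
        where open ≡-Reasoning

  unique-⇔⇒↭ : ∀ {A : Set} {xs ys : List A} → Unique xs → Unique ys →
               (∀ {z} → z ∈ xs ⇔ z ∈ ys) → xs ↭ ys
  unique-⇔⇒↭ uxs uys same = ∼bag⇒↭ (unique∧set⇒bag uxs uys same)

  χ-sum-bound : ∀ m t → t < m → ∀ L → Unique L →
               ((w : List ℕ) → (w ∈ L → IsBoolean (suc m) w) × (IsBoolean (suc m) w → w ∈ L)) →
               21 * sumBy (χ (suc t)) L ≤ 10 * length L
  χ-sum-bound m t t<m L unique-L L≈booleans =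
    subst₂ (λ x n → 21 * x ≤ 10 * n) (sum-↭ (map⁺ (χ (suc t)) booleans↭L)) (↭-length booleans↭L)
      (χ-booleans-bound t t<m)
    where
    booleans↭L : booleans m ↭ L
    booleans↭L = unique-⇔⇒↭ (booleans-unique m) unique-L λ {w} → mk⇔
      (proj₂ (L≈booleans w) ∘ Equivalence.to (∈-booleans⇔ m))
      (Equivalence.from (∈-booleans⇔ m) ∘ proj₁ (L≈booleans w))

  -- From the count to the expectation

  sumℤ-map-minus : ∀ {A : Set} (a : ℤ) (g : A → ℕ) xs →
                   sumℤ (map (λ x → a ℤ.- + g x) xs) ≡ + length xs ℤ.* a ℤ.- + sumBy g xs
  sumℤ-map-minus a g []       = empty a
    where
    empty : ∀ a → + 0 ≡ + 0 ℤ.* a ℤ.- + 0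
    empty = ℤ-solve-∀
  sumℤ-map-minus a g (x ∷ xs) = begin
    (a ℤ.- + g x) ℤ.+ sumℤ (map (λ x → a ℤ.- + g x) xs)
      ≡⟨ cong (λ s → (a ℤ.- + g x) ℤ.+ s) (sumℤ-map-minus a g xs) ⟩
    (a ℤ.- + g x) ℤ.+ (+ length xs ℤ.* a ℤ.- + sumBy g xs)
      ≡⟨ regroup a (+ length xs) (+ g x) (+ sumBy g xs) ⟩
    (+ 1 ℤ.+ + length xs) ℤ.* a ℤ.- (+ g x ℤ.+ + sumBy g xs)
      ≡⟨ cong₂ (λ n s → n ℤ.* a ℤ.- s) (sym (ℤP.pos-+ 1 (length xs))) (sym (ℤP.pos-+ (g x) _)) ⟩
    + suc (length xs) ℤ.* a ℤ.- + (g x + sumBy g xs)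
      ∎
    where
    open ≡-Reasoning
    regroup : ∀ a n y s → (a ℤ.- y) ℤ.+ (n ℤ.* a ℤ.- s) ≡ (+ 1 ℤ.+ n) ℤ.* a ℤ.- (y ℤ.+ s)
    regroup = ℤ-solve-∀

  sumΔ-closed : ∀ i L → let n = + length L; c = + sumBy (χ i) L in
                sumΔ i L ≡ n ℤ.* (n ℤ.- c) ℤ.- n ℤ.* c
  sumΔ-closed i L = begin
    sumℤ (map (λ u → sumℤ (map (Δ i u) L)) L)
      ≡⟨ cong sumℤ (map-cong (λ u → sumℤ-map-minus (+ 1 ℤ.- + χ i u) (χ i) L) L) ⟩
    sumℤ (map (λ u → n ℤ.* (+ 1 ℤ.- + χ i u) ℤ.- c) L)
      ≡⟨ cong sumℤ (map-cong (λ u → trans (regroup n c (+ χ i u))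
                                          (cong (λ s → (n ℤ.- c) ℤ.- s) (sym (ℤP.pos-* N (χ i u))))) L) ⟩
    sumℤ (map (λ u → (n ℤ.- c) ℤ.- + (N * χ i u)) L)
      ≡⟨ sumℤ-map-minus (n ℤ.- c) (λ u → N * χ i u) L ⟩
    n ℤ.* (n ℤ.- c) ℤ.- + sumBy (λ u → N * χ i u) L
      ≡⟨ cong (λ s → n ℤ.* (n ℤ.- c) ℤ.- s) (trans (cong +_ (sumBy-*ˡ N (χ i) L)) (ℤP.pos-* N _)) ⟩
    n ℤ.* (n ℤ.- c) ℤ.- n ℤ.* c
      ∎
    where
    open ≡-Reasoning
    N = length L
    n = + N
    c = + sumBy (χ i) L
    regroup : ∀ n c x → n ℤ.* (+ 1 ℤ.- x) ℤ.- c ≡ (n ℤ.- c) ℤ.- n ℤ.* x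
    regroup = ℤ-solve-∀

  sumΔ-scaled : ∀ i L r → 21 * sumBy (χ i) L + r ≡ 10 * length L →
                + 21 ℤ.* sumΔ i L ≡ + length L ℤ.* + length L ℤ.+ + (2 * length L * r)
  sumΔ-scaled i L r 21C+r≡10N = begin
    + 21 ℤ.* sumΔ i L
      ≡⟨ cong (λ s → + 21 ℤ.* s) (sumΔ-closed i L) ⟩
    + 21 ℤ.* (n ℤ.* (n ℤ.- c) ℤ.- n ℤ.* c)
      ≡⟨ expand n c (+ r) ⟩
    n ℤ.* n ℤ.+ + 2 ℤ.* n ℤ.* + r ℤ.+ + 2 ℤ.* n ℤ.* (+ 10 ℤ.* n ℤ.- (+ 21 ℤ.* c ℤ.+ + r))
      ≡⟨ cong (λ z → n ℤ.* n ℤ.+ + 2 ℤ.* n ℤ.* + r ℤ.+ + 2 ℤ.* n ℤ.* (+ 10 ℤ.* n ℤ.- z)) 21c+r≡10n ⟩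
    n ℤ.* n ℤ.+ + 2 ℤ.* n ℤ.* + r ℤ.+ + 2 ℤ.* n ℤ.* (+ 10 ℤ.* n ℤ.- + 10 ℤ.* n)
      ≡⟨ cancel n (+ r) (+ 10 ℤ.* n) ⟩
    n ℤ.* n ℤ.+ + 2 ℤ.* n ℤ.* + r
      ≡⟨ cong (λ s → n ℤ.* n ℤ.+ s) (sym (trans (ℤP.pos-* (2 * N) r) (cong (ℤ._* + r) (ℤP.pos-* 2 N)))) ⟩
    n ℤ.* n ℤ.+ + (2 * N * r)
      ∎
    where
    open ≡-Reasoning
    N = length L
    n = + N
    c = + sumBy (χ i) L
    21c+r≡10n : + 21 ℤ.* c ℤ.+ + r ≡ + 10 ℤ.* n
    21c+r≡10n = trans (cong (λ s → s ℤ.+ + r) (sym (ℤP.pos-* 21 (sumBy (χ i) L))))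
                  (trans (sym (ℤP.pos-+ (21 * sumBy (χ i) L) r)) (trans (cong +_ 21C+r≡10N) (ℤP.pos-* 10 N)))
    expand : ∀ n c r → + 21 ℤ.* (n ℤ.* (n ℤ.- c) ℤ.- n ℤ.* c)
                       ≡ n ℤ.* n ℤ.+ + 2 ℤ.* n ℤ.* r ℤ.+ + 2 ℤ.* n ℤ.* (+ 10 ℤ.* n ℤ.- (+ 21 ℤ.* c ℤ.+ r))
    expand = ℤ-solve-∀
    cancel : ∀ n r z → n ℤ.* n ℤ.+ + 2 ℤ.* n ℤ.* r ℤ.+ + 2 ℤ.* n ℤ.* (z ℤ.- z)
                       ≡ n ℤ.* n ℤ.+ + 2 ℤ.* n ℤ.* r
    cancel = ℤ-solve-∀

  sumΔ-lower : ∀ i L → 21 * sumBy (χ i) L ≤ 10 * length L →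
               + length L ℤ.* + length L ℤ.≤ + 21 ℤ.* sumΔ i L
  sumΔ-lower i L 21C≤10N with m≤n⇒∃[o]m+o≡n 21C≤10N
  ... | r , 21C+r≡10N = ℤP.≤-trans (ℤP.i≤i+j _ (+ (2 * length L * r)))
                                    (ℤP.≤-reflexive (sym (sumΔ-scaled i L r 21C+r≡10N)))

  η : ℚ
  η = + 1 /ℚ 21

  η-positive : 0ℚ <ℚ η
  η-positive = ℚP.toℚᵘ-cancel-< (ℚᵘ.*<* (ℤ.+<+ (s≤s z≤n)))

  η-scaled : ∀ N S → + N ℤ.* + N ℤ.≤ + 21 ℤ.* S → η *ℚ (ℕtoℚ N *ℚ ℕtoℚ N) ≤ℚ ℤtoℚ S
  η-scaled N S N²≤21S = ℚP.toℚᵘ-cancel-≤ (begin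
    toℚᵘ (η *ℚ (ℕtoℚ N *ℚ ℕtoℚ N))
      ≃⟨ ℚP.toℚᵘ-homo-* η (ℕtoℚ N *ℚ ℕtoℚ N) ⟩
    toℚᵘ η ℚᵘ.* toℚᵘ (ℕtoℚ N *ℚ ℕtoℚ N)
      ≃⟨ ℚᵘP.*-cong (toℚᵘ-/ (+ 1) 20) (ℚP.toℚᵘ-homo-* (ℕtoℚ N) (ℕtoℚ N)) ⟩
    mkℚᵘ (+ 1) 20 ℚᵘ.* (toℚᵘ (ℕtoℚ N) ℚᵘ.* toℚᵘ (ℕtoℚ N))
      ≃⟨ ℚᵘP.*-congˡ {mkℚᵘ (+ 1) 20} (ℚᵘP.*-cong (toℚᵘ-/ (+ N) 0) (toℚᵘ-/ (+ N) 0)) ⟩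
    mkℚᵘ (+ 1) 20 ℚᵘ.* (mkℚᵘ (+ N) 0 ℚᵘ.* mkℚᵘ (+ N) 0)
      ≤⟨ ℚᵘ.*≤* (subst₂ ℤ._≤_ (unit (+ N)) (ℤP.*-comm (+ 21) S) N²≤21S) ⟩
    mkℚᵘ S 0
      ≃⟨ ℚᵘP.≃-sym (toℚᵘ-/ S 0) ⟩
    toℚᵘ (ℤtoℚ S)
      ∎)
    where
    open ℚᵘP.≤-Reasoning
    toℚᵘ-/ : ∀ z d → toℚᵘ (z /ℚ suc d) ℚᵘ.≃ mkℚᵘ z d
    toℚᵘ-/ z d = ℚP.toℚᵘ-fromℚᵘ (mkℚᵘ z d)
    unit : ∀ n → n ℤ.* n ≡ (+ 1 ℤ.* (n ℤ.* n)) ℤ.* + 1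
    unit = ℤ-solve-∀


open import Defs
open import Data.Nat using (ℕ; _≤_; _∸_; suc; s≤s; z≤n)
open import Data.Rational using (ℚ; 0ℚ; _<_; _*_)
open import Data.Rational using () renaming (_≤_ to _≤ℚ_)
open import Data.List using (List; length)
open import Data.List.Relation.Unary.Unique.Propositional using (Unique)
open import Data.List.Membership.Propositional using (_∈_)
open import Data.Product using (Σ; _×_; _,_)

open BooleanPermutations using (η; η-positive; η-scaled; sumΔ-lower; χ-sum-bound)

lemma5p19 : Σ ℚ λ η → (0ℚ < η) ×
  ((n : ℕ) → 3 ≤ n → (i : ℕ) → 1 ≤ i → i ≤ n ∸ 1 →
   (L : List (List ℕ)) → Unique L →
   ((w : List ℕ) → (w ∈ L → IsBoolean n w) × (IsBoolean n w → w ∈ L)) →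
   (η * (ℕtoℚ (length L) * ℕtoℚ (length L))) ≤ℚ ℤtoℚ (sumΔ i L))
lemma5p19 = η , η-positive , λ where
  (suc m) (s≤s _) (suc t) (s≤s z≤n) t<m L unique-L L≈booleans →
    η-scaled (length L) (sumΔ (suc t) L) (sumΔ-lower (suc t) L (χ-sum-bound m t t<m L unique-L L≈booleans))
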